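{- Let $\mathcal L$ be a bounded lattice with a normal lattice operator $f$ of distribution type $(i_1,\ldots,i_n;1)$ and a normal lattice operator $h$ of distribution type $(t_1,\ldots,t_n;\partial)$, and let $(X,I,Y,R,S)$ be its canonical frame. Then: (1) the frame is separated; (2) for all $\vec u$ with $u_j\in Z_{i_j}$ and $\vec v$ with $v_j\in Z_{t_j}$, the sections $R\vec u$ and $S\vec v$ are closed elements of $\mathcal G(X)$ and $\mathcal G(Y)$, respectively; (3) for all $x\in X$, $y\in Y$, the $n$-ary relations $xR$ and $yS$ are decreasing in every argument place.
   Context: For a bounded lattice $\mathcal L$, $\mathcal L^1=\mathcal L$, $\mathcal L^\partial$ the opposite lattice; a normal lattice operator of type $(i_1,\ldots,i_n;i_{n+1})$ distributes over finite joins in each argument as a map $\mathcal L^{i_1}\times\cdots\times\mathcal L^{i_n}\to\mathcal L^{i_{n+1}}$. Canonical frame: $X$ = filters, $Y$ = ideals of $\mathcal L$; $xIy$ iff $x\cap y=\emptyset$, $x\perp y$ iff $x\cap y\ne\emptyset$; $Z_1=X$, $Z_\partial=Y$. For $\vec u$ with $u_j\in Z_{i_j}$, $\widehat f(\vec u)$ is the filter generated by $\{f(\vec a):a_j\in u_j\ \forall j\}$, and $xR\vec u$ iff $\widehat f(\vec u)\subseteq x$; for $\vec v$ with $v_j\in Z_{t_j}$, $\widehat h(\vec v)$ is the ideal generated by $\{h(\vec a):a_j\in v_j\ \forall j\}$ and $yS\vec v$ iff $\widehat h(\vec v)\subseteq y$. General: $U^\perp=\{y:x\perp y\ \forall x\in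 U\}$, ${}^\perp V=\{x:x\perp y\ \forall y\in V\}$; $\mathcal G(X)$ = stable sets $A={}^\perp(A^\perp)$, $\mathcal G(Y)$ = co-stable sets $B=({}^\perp B)^\perp$; preorders $x\le z$ iff $\{x\}^\perp\subseteq\{z\}^\perp$, $y\le v$ iff ${}^\perp\{y\}\subseteq{}^\perp\{v\}$; separated means these are partial orders; $\Gamma u=\{w:u\le w\}$; closed elements are the sets $\Gamma u$; $R\vec u=\{x:xR\vec u\}$; $xR$ is decreasing in argument $k$ if $xR\vec u[w]_k$ and $w'\le w$ imply $xR\vec u[w']_k$. -}

module Defs where

open import Level using (Level; _⊔_; suc)
open import Data.Nat using (ℕ)
open import Data.Fin using (Fin; _≟_)
open import Data.List using (List; foldr; map)
open import Data.List.Relation.Unary.All using (All)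
open import Data.Product using (Σ; ∃; _×_; _,_)
open import Relation.Nullary using (¬_; yes; no)
open import Relation.Unary using (Pred; _⊆_)
open import Relation.Binary.PropositionalEquality using (_≡_; refl)
open import Relation.Binary.Lattice.Bundles using (BoundedLattice)

-- Distribution polarity: one = 1 (the lattice itself), dual = ∂ (opposite lattice)
data Polarity : Set where
  one dual : Polarity

upd : ∀ {a} {A : Set a} {n : ℕ} → (Fin n → A) → Fin n → A → Fin n → A
upd u k w j with k ≟ j
... | yes _ = w
... | no _ = u j

updᵈ : ∀ {a b} {T : Set a} {P : T → Set b} {n : ℕ} {i : Fin n → T}
     → ((j : Fin n) → P (i j)) → (k : Fin n) → P (i k) → (j : Fin n) → P (i j)
updᵈ u k w j with k ≟ j
... | yes refl = w
... | no _ = u j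

module Frame {c ℓ₁ ℓ₂} (L : BoundedLattice c ℓ₁ ℓ₂) where
  open BoundedLattice L

  ℓ : Level
  ℓ = c ⊔ ℓ₁ ⊔ ℓ₂

  -- finite joins in L^i
  joinᵖ : Polarity → Carrier → Carrier → Carrier
  joinᵖ one  = _∨_
  joinᵖ dual = _∧_

  botᵖ : Polarity → Carrier
  botᵖ one  = ⊥
  botᵖ dual = ⊤

  Congruentₙ : {n : ℕ} → ((Fin n → Carrier) → Carrier) → Set (c ⊔ ℓ₁)
  Congruentₙ f = ∀ a b → (∀ j → a j ≈ b j) → f a ≈ f b

  IsNormalOperator : {n : ℕ} → (Fin n → Polarity) → Polarity
                   → ((Fin n → Carrier) → Carrier) → Set (c ⊔ ℓ₁)
  IsNormalOperator {n} is o f =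
    Congruentₙ f
    × (∀ (a : Fin n → Carrier) k p q →
         f (upd a k (joinᵖ (is k) p q)) ≈ joinᵖ o (f (upd a k p)) (f (upd a k q)))
    × (∀ (a : Fin n → Carrier) k → f (upd a k (botᵖ (is k))) ≈ botᵖ o)

  -- filters (possibly improper) and ideals, as predicates on the carrier
  record Filter : Set (suc ℓ) where
    field
      mem    : Pred Carrier ℓ
      top    : mem ⊤
      upward : ∀ {a b} → a ≤ b → mem a → mem b
      meet   : ∀ {a b} → mem a → mem b → mem (a ∧ b)

  record Ideal : Set (suc ℓ) where
    field
      mem      : Pred Carrier ℓ
      bot      : mem ⊥
      downward : ∀ {a b} → b ≤ a → mem a → mem b
      join     : ∀ {a b} → mem a → mem b → mem (a ∨ b)

  X : Set (suc ℓ)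
  X = Filter

  Y : Set (suc ℓ)
  Y = Ideal

  _I_ : X → Y → Set ℓ
  x I y = ¬ (∃ λ a → Filter.mem x a × Ideal.mem y a)

  _⊥⊥_ : X → Y → Set ℓ
  x ⊥⊥ y = ∃ λ a → Filter.mem x a × Ideal.mem y a

  Z : Polarity → Set (suc ℓ)
  Z one  = X
  Z dual = Y

  memZ : (i : Polarity) → Z i → Pred Carrier ℓ
  memZ one  = Filter.mem
  memZ dual = Ideal.mem

  _ᵖ : ∀ {a} → Pred X a → Pred Y (suc ℓ ⊔ a)
  (U ᵖ) y = ∀ x → U x → x ⊥⊥ y

  ᵖ_ : ∀ {a} → Pred Y a → Pred X (suc ℓ ⊔ a)
  (ᵖ V) x = ∀ y → V y → x ⊥⊥ y

  _≐_ : ∀ {A : Set (suc ℓ)} {a b} → Pred A a → Pred A b → Set _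
  P ≐ Q = P ⊆ Q × Q ⊆ P

  IsStable : ∀ {a} → Pred X a → Set _
  IsStable A = A ≐ (ᵖ (A ᵖ))

  IsCoStable : ∀ {a} → Pred Y a → Set _
  IsCoStable B = B ≐ ((ᵖ B) ᵖ)

  ｛_｝X : X → Pred X (suc ℓ)
  ｛ x ｝X = λ z → z ≡ x

  ｛_｝Y : Y → Pred Y (suc ℓ)
  ｛ y ｝Y = λ z → z ≡ y

  _≤X_ : X → X → Set (suc ℓ)
  x ≤X z = (｛ x ｝X ᵖ) ⊆ (｛ z ｝X ᵖ)

  _≤Y_ : Y → Y → Set (suc ℓ)
  y ≤Y v = (ᵖ ｛ y ｝Y) ⊆ (ᵖ ｛ v ｝Y)

  _≤Z_ : {i : Polarity} → Z i → Z i → Set (suc ℓ)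
  _≤Z_ {one}  = _≤X_
  _≤Z_ {dual} = _≤Y_

  _≡X_ : X → X → Set ℓ
  x ≡X z = Filter.mem x ⊆ Filter.mem z × Filter.mem z ⊆ Filter.mem x

  _≡Y_ : Y → Y → Set ℓ
  y ≡Y v = Ideal.mem y ⊆ Ideal.mem v × Ideal.mem v ⊆ Ideal.mem y

  Separated : Set (suc ℓ)
  Separated = (∀ x z → x ≤X z → z ≤X x → x ≡X z)
            × (∀ y v → y ≤Y v → v ≤Y y → y ≡Y v)

  ΓX : X → Pred X (suc ℓ)
  ΓX x = λ w → x ≤X w

  ΓY : Y → Pred Y (suc ℓ)
  ΓY y = λ w → y ≤Y w

  IsClosedX : ∀ {a} → Pred X a → Set _
  IsClosedX A = IsStable A × Σ X (λ x → A ≐ ΓX x)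

  IsClosedY : ∀ {a} → Pred Y a → Set _
  IsClosedY B = IsCoStable B × Σ Y (λ y → B ≐ ΓY y)

  module Ops {n : ℕ} where
    Tuple : (Fin n → Polarity) → Set (suc ℓ)
    Tuple is = (j : Fin n) → Z (is j)

    InTuple : (is : Fin n → Polarity) → Tuple is → (Fin n → Carrier) → Set ℓ
    InTuple is u a = ∀ j → memZ (is j) (u j) (a j)

    -- \hat f(u): filter generated by { f(a) : a_j ∈ u_j }
    fHat : (is : Fin n → Polarity) → ((Fin n → Carrier) → Carrier) → Tuple is → Pred Carrier ℓ
    fHat is f u b = Σ (List (Fin n → Carrier)) λ as →
                      All (InTuple is u) as × (foldr _∧_ ⊤ (map f as) ≤ b)

    -- \hat h(v): ideal generated by { h(a) : a_j ∈ v_j }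
    hHat : (ts : Fin n → Polarity) → ((Fin n → Carrier) → Carrier) → Tuple ts → Pred Carrier ℓ
    hHat ts h v b = Σ (List (Fin n → Carrier)) λ as →
                      All (InTuple ts v) as × (b ≤ foldr _∨_ ⊥ (map h as))

    Rel-R : (is : Fin n → Polarity) → ((Fin n → Carrier) → Carrier) → X → Tuple is → Set ℓ
    Rel-R is f x u = fHat is f u ⊆ Filter.mem x

    Rel-S : (ts : Fin n → Polarity) → ((Fin n → Carrier) → Carrier) → Y → Tuple ts → Set ℓ
    Rel-S ts h y v = hHat ts h v ⊆ Ideal.mem y

    sectR : (is : Fin n → Polarity) → ((Fin n → Carrier) → Carrier) → Tuple is → Pred X ℓ
    sectR is f u x = Rel-R is f x u

    sectS : (ts : Fin n → Polarity) → ((Fin n → Carrier) → Carrier) → Tuple ts → Pred Y ℓ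
    sectS ts h v y = Rel-S ts h y v

    DecreasingAll : (is : Fin n → Polarity) → Pred (Tuple is) ℓ → Set (suc ℓ)
    DecreasingAll is T = ∀ (u : Tuple is) (k : Fin n) (w w′ : Z (is k)) →
      T (updᵈ {P = Z} u k w) → w′ ≤Z w → T (updᵈ {P = Z} u k w′)

  open Ops public

open Frame public

-- In the canonical frame the Galois connection is tested against principal
-- filters ↑a and ideals ↓a: a filter x meets ↓a exactly when a ∈ x.  Hence the
-- frame orders ≤X and ≤Y are plain inclusion of filters and of ideals, which
-- gives separation.  The relation x R u says that x contains the filter f̂(u), so
-- the section R u is the principal upset Γ f̂(u); stability follows by testing
-- against ↓b for b ∈ f̂(u).  Finally, w′ ≤ w means w′ ⊆ w, so shrinking one
-- coordinate of u shrinks f̂(u), making x R decreasing.  Dually for h and S.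
module Submission where

import Defs
open Defs using (Polarity; one; dual; updᵈ; module Frame)
open import Level using (Lift; lift)
open import Data.Nat using (ℕ)
open import Data.Fin using (Fin; _≟_)
open import Data.List using (List; []; _∷_; _++_; foldr; map)
open import Data.List.Properties using (map-++)
open import Data.List.Relation.Unary.All as All using (All)
open import Data.List.Relation.Unary.All.Properties using (++⁺)
open import Data.Product using (Σ; _×_; _,_)
open import Relation.Nullary using (yes; no)
open import Relation.Unary using (Pred; _⊆_)
import Relation.Binary.PropositionalEquality as ≡
open import Relation.Binary.Lattice.Bundles using (BoundedLattice)
import Relation.Binary.Lattice.Properties.MeetSemilattice as MeetProperties
import Relation.Binary.Lattice.Properties.JoinSemilattice as JoinProperties

module CanonicalFrame {c ℓ₁ ℓ₂} (L : BoundedLattice c ℓ₁ ℓ₂) where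
  open BoundedLattice L
  open MeetProperties meetSemilattice using (∧-monotonic)
  open JoinProperties joinSemilattice using (∨-monotonic)
  open Frame L

  ⋀ : List Carrier → Carrier
  ⋀ = foldr _∧_ ⊤

  ⋁ : List Carrier → Carrier
  ⋁ = foldr _∨_ ⊥

  ⋀-++ˡ : ∀ as bs → ⋀ (as ++ bs) ≤ ⋀ as
  ⋀-++ˡ []       bs = maximum _
  ⋀-++ˡ (a ∷ as) bs = ∧-monotonic refl (⋀-++ˡ as bs)

  ⋀-++ʳ : ∀ as bs → ⋀ (as ++ bs) ≤ ⋀ bs
  ⋀-++ʳ []       bs = refl
  ⋀-++ʳ (a ∷ as) bs = trans (x∧y≤y a _) (⋀-++ʳ as bs)

  ⋁-++ˡ : ∀ as bs → ⋁ as ≤ ⋁ (as ++ bs)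
  ⋁-++ˡ []       bs = minimum _
  ⋁-++ˡ (a ∷ as) bs = ∨-monotonic refl (⋁-++ˡ as bs)

  ⋁-++ʳ : ∀ as bs → ⋁ bs ≤ ⋁ (as ++ bs)
  ⋁-++ʳ []       bs = refl
  ⋁-++ʳ (a ∷ as) bs = trans (⋁-++ʳ as bs) (y≤x∨y a _)

  ⋀-map-++ : ∀ {a} {A : Set a} (g : A → Carrier) as bs →
             ⋀ (map g (as ++ bs)) ≤ ⋀ (map g as) ∧ ⋀ (map g bs)
  ⋀-map-++ g as bs rewrite map-++ g as bs =
    ∧-greatest (⋀-++ˡ (map g as) _) (⋀-++ʳ (map g as) _)

  ⋁-map-++ : ∀ {a} {A : Set a} (g : A → Carrier) as bs →
             ⋁ (map g as) ∨ ⋁ (map g bs) ≤ ⋁ (map g (as ++ bs))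
  ⋁-map-++ g as bs rewrite map-++ g as bs =
    ∨-least (⋁-++ˡ (map g as) _) (⋁-++ʳ (map g as) _)

  ↑_ : Carrier → X
  ↑ a = record
    { mem    = λ b → Lift ℓ (a ≤ b)
    ; top    = lift (maximum a)
    ; upward = λ { b≤b′ (lift a≤b) → lift (trans a≤b b≤b′) }
    ; meet   = λ { (lift a≤b) (lift a≤b′) → lift (∧-greatest a≤b a≤b′) }
    }

  ↓_ : Carrier → Y
  ↓ a = record
    { mem      = λ b → Lift ℓ (b ≤ a)
    ; bot      = lift (minimum a)
    ; downward = λ { b′≤b (lift b≤a) → lift (trans b′≤b b≤a) }
    ; join     = λ { (lift b≤a) (lift b′≤a) → lift (∨-least b≤a b′≤a) }
    }

  -- The paper's f̂(u) is imageFilter f (InTuple is u), and ĥ(v) is imageIdeal h (InTuple ts v).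
  imageFilter : {A : Set c} → (A → Carrier) → Pred A ℓ → X
  imageFilter g P = record
    { mem    = λ b → Σ (List _) λ as → All P as × ⋀ (map g as) ≤ b
    ; top    = [] , All.[] , refl
    ; upward = λ { b≤b′ (as , Pas , ⋀≤b) → as , Pas , trans ⋀≤b b≤b′ }
    ; meet   = λ { (as , Pas , ⋀≤b) (bs , Pbs , ⋀≤b′) →
        as ++ bs , ++⁺ Pas Pbs , trans (⋀-map-++ g as bs) (∧-monotonic ⋀≤b ⋀≤b′) }
    }

  imageIdeal : {A : Set c} → (A → Carrier) → Pred A ℓ → Y
  imageIdeal g P = record
    { mem      = λ b → Σ (List _) λ as → All P as × b ≤ ⋁ (map g as)
    ; bot      = [] , All.[] , refl
    ; downward = λ { b′≤b (as , Pas , b≤⋁) → as , Pas , trans b′≤b b≤⋁ }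
    ; join     = λ { (as , Pas , b≤⋁) (bs , Pbs , b′≤⋁) →
        as ++ bs , ++⁺ Pas Pbs , trans (∨-monotonic b≤⋁ b′≤⋁) (⋁-map-++ g as bs) }
    }

  imageFilter-mono : {A : Set c} (g : A → Carrier) {P Q : Pred A ℓ} →
                     P ⊆ Q → Filter.mem (imageFilter g P) ⊆ Filter.mem (imageFilter g Q)
  imageFilter-mono g P⊆Q (as , Pas , ⋀≤b) = as , All.map P⊆Q Pas , ⋀≤b

  imageIdeal-mono : {A : Set c} (g : A → Carrier) {P Q : Pred A ℓ} →
                    P ⊆ Q → Ideal.mem (imageIdeal g P) ⊆ Ideal.mem (imageIdeal g Q)
  imageIdeal-mono g P⊆Q (as , Pas , b≤⋁) = as , All.map P⊆Q Pas , b≤⋁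

  ∈⇒⊥⊥↓ : ∀ {x a} → Filter.mem x a → x ⊥⊥ (↓ a)
  ∈⇒⊥⊥↓ a∈x = _ , a∈x , lift refl

  ⊥⊥↓⇒∈ : ∀ {x a} → x ⊥⊥ (↓ a) → Filter.mem x a
  ⊥⊥↓⇒∈ {x} (b , b∈x , lift b≤a) = Filter.upward x b≤a b∈x

  ∈⇒⊥⊥↑ : ∀ {y a} → Ideal.mem y a → (↑ a) ⊥⊥ y
  ∈⇒⊥⊥↑ a∈y = _ , lift refl , a∈y

  ⊥⊥↑⇒∈ : ∀ {y a} → (↑ a) ⊥⊥ y → Ideal.mem y a
  ⊥⊥↑⇒∈ {y} (b , lift a≤b , b∈y) = Ideal.downward y a≤b b∈y

  ≤X⇒⊆ : ∀ {x z} → x ≤X z → Filter.mem x ⊆ Filter.mem z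
  ≤X⇒⊆ {x} {z} x≤z {a} a∈x = ⊥⊥↓⇒∈ {z} (x≤z {↓ a} (λ { _ ≡.refl → ∈⇒⊥⊥↓ {x} a∈x }) z ≡.refl)

  ⊆⇒≤X : ∀ {x z} → Filter.mem x ⊆ Filter.mem z → x ≤X z
  ⊆⇒≤X {x} x⊆z x⊥⊥y _ ≡.refl with x⊥⊥y x ≡.refl
  ... | a , a∈x , a∈y = a , x⊆z a∈x , a∈y

  ≤Y⇒⊆ : ∀ {y v} → y ≤Y v → Ideal.mem y ⊆ Ideal.mem v
  ≤Y⇒⊆ {y} {v} y≤v {a} a∈y = ⊥⊥↑⇒∈ {v} (y≤v {↑ a} (λ { _ ≡.refl → ∈⇒⊥⊥↑ {y} a∈y }) v ≡.refl)

  ⊆⇒≤Y : ∀ {y v} → Ideal.mem y ⊆ Ideal.mem v → y ≤Y v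
  ⊆⇒≤Y {y} y⊆v x⊥⊥y _ ≡.refl with x⊥⊥y y ≡.refl
  ... | a , a∈x , a∈y = a , a∈x , y⊆v a∈y

  ≤Z⇒⊆ : ∀ p {w w′ : Z p} → _≤Z_ {p} w′ w → memZ p w′ ⊆ memZ p w
  ≤Z⇒⊆ one  = ≤X⇒⊆
  ≤Z⇒⊆ dual = ≤Y⇒⊆

  ≤X-antisym : ∀ x z → x ≤X z → z ≤X x → x ≡X z
  ≤X-antisym x z x≤z z≤x =
    ≤X⇒⊆ {x} {z} (λ {y} → x≤z {y}) , ≤X⇒⊆ {z} {x} (λ {y} → z≤x {y})

  ≤Y-antisym : ∀ y v → y ≤Y v → v ≤Y y → y ≡Y v
  ≤Y-antisym y v y≤v v≤y =
    ≤Y⇒⊆ {y} {v} (λ {x} → y≤v {x}) , ≤Y⇒⊆ {v} {y} (λ {x} → v≤y {x})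

  separated : Separated
  separated = ≤X-antisym , ≤Y-antisym

  ᵖᵖ-extensiveX : ∀ {a} {A : Pred X a} → A ⊆ ᵖ (A ᵖ)
  ᵖᵖ-extensiveX x∈A _ y∈Aᵖ = y∈Aᵖ _ x∈A

  ᵖᵖ-extensiveY : ∀ {a} {B : Pred Y a} → B ⊆ (ᵖ B) ᵖ
  ᵖᵖ-extensiveY y∈B _ x∈ᵖB = x∈ᵖB _ y∈B

  Above : X → Pred X ℓ
  Above F x = Filter.mem F ⊆ Filter.mem x

  Below : Y → Pred Y ℓ
  Below J y = Ideal.mem J ⊆ Ideal.mem y

  Above-isStable : ∀ F → IsStable (Above F)
  Above-isStable F = (λ {x} → ᵖᵖ-extensiveX {x = x}) , λ {x} x∈ᵖᵖ b∈F →
    ⊥⊥↓⇒∈ {x} (x∈ᵖᵖ (↓ _) λ x′ F⊆x′ → ∈⇒⊥⊥↓ {x′} (F⊆x′ b∈F))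

  Below-isCoStable : ∀ J → IsCoStable (Below J)
  Below-isCoStable J = (λ {y} → ᵖᵖ-extensiveY {x = y}) , λ {y} y∈ᵖᵖ b∈J →
    ⊥⊥↑⇒∈ {y} (y∈ᵖᵖ (↑ _) λ y′ J⊆y′ → ∈⇒⊥⊥↑ {y′} (J⊆y′ b∈J))

  Above-isClosed : ∀ F → IsClosedX (Above F)
  Above-isClosed F = Above-isStable F , F , ⊆⇒≤X , ≤X⇒⊆

  Below-isClosed : ∀ J → IsClosedY (Below J)
  Below-isClosed J = Below-isCoStable J , J , ⊆⇒≤Y , ≤Y⇒⊆

  module _ {n : ℕ} (is : Fin n → Polarity) (f : (Fin n → Carrier) → Carrier) where

    sectR-isClosed : ∀ u → IsClosedX (sectR is f u)
    sectR-isClosed u = Above-isClosed (imageFilter f (InTuple is u))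

    sectS-isClosed : ∀ v → IsClosedY (sectS is f v)
    sectS-isClosed v = Below-isClosed (imageIdeal f (InTuple is v))

    InTuple-updᵈ-mono : ∀ (u : Tuple is) k {w w′} → _≤Z_ {is k} w′ w →
                        InTuple is (updᵈ {P = Z} u k w′) ⊆ InTuple is (updᵈ {P = Z} u k w)
    InTuple-updᵈ-mono u k {w} {w′} w′≤w a∈u[w′] j = updᵈ-mono j (a∈u[w′] j)
      where
      updᵈ-mono : ∀ j → memZ (is j) (updᵈ {P = Z} u k w′ j) ⊆ memZ (is j) (updᵈ {P = Z} u k w j)
      updᵈ-mono j with k ≟ j
      ... | yes ≡.refl = ≤Z⇒⊆ (is k) w′≤w
      ... | no _       = λ a∈uj → a∈uj

    Rel-R-decreasing : ∀ x → DecreasingAll is (Rel-R is f x)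
    Rel-R-decreasing x u k w w′ xRu[w] w′≤w b∈f̂ =
      xRu[w] (imageFilter-mono f (InTuple-updᵈ-mono u k w′≤w) b∈f̂)

    Rel-S-decreasing : ∀ y → DecreasingAll is (Rel-S is f y)
    Rel-S-decreasing y v k w w′ ySv[w] w′≤w b∈ĥ =
      ySv[w] (imageIdeal-mono f (InTuple-updᵈ-mono v k w′≤w) b∈ĥ)

open Defs
open CanonicalFrame

lemma4p2 : ∀ {c ℓ₁ ℓ₂} (L : BoundedLattice c ℓ₁ ℓ₂) (n : ℕ)
    (is ts : Fin n → Polarity)
    (f h : (Fin n → BoundedLattice.Carrier L) → BoundedLattice.Carrier L)
    → IsNormalOperator L is one f
    → IsNormalOperator L ts dual h
    → Separated L
    × (∀ (u : Tuple L is) → IsClosedX L (sectR L is f u))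
    × (∀ (v : Tuple L ts) → IsClosedY L (sectS L ts h v))
    × (∀ (x : X L) → DecreasingAll L is (Rel-R L is f x))
    × (∀ (y : Y L) → DecreasingAll L ts (Rel-S L ts h y))
lemma4p2 L n is ts f h _ _ =
    separated L
  , sectR-isClosed L is f
  , sectS-isClosed L ts h
  , Rel-R-decreasing L is f
  , Rel-S-decreasing L ts h
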